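{- If $H$ is a linear hypergraph with minimum vertex degree $\delta$ and at least $\delta$ hyperedges, then $b_L(H)\ge |V(H)|-|E(H)|+\binom{\delta}{2}$.
   Context: A hypergraph $H$ consists of a finite vertex set $V(H)$ and a finite collection $E(H)$ of subsets of $V(H)$; it is linear if every two distinct hyperedges intersect in at most one vertex. The degree of a vertex is the number of hyperedges containing it. Lazy burning: a set $B\subseteq V(H)$ is burned initially; in each subsequent round every unburned vertex $v$ for which some hyperedge $h\ni v$ has $h\setminus\{v\}$ entirely burned becomes burned. $B$ is a lazy burning set if eventually all vertices burn; $b_L(H)$ is the minimum size of a lazy burning set. -}

module Defs where

open import Data.Nat using (ℕ; zero; suc; _≤_)
open import Data.Fin using (Fin)
open import Data.Fin.Subset using (Subset; _∈_; _∩_; ∣_∣)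
open import Data.Vec using (tabulate; lookup)
open import Data.Product using (Σ; _×_)
open import Data.Sum using (_⊎_)
open import Relation.Nullary using (¬_)
open import Relation.Binary.PropositionalEquality using (_≡_; _≢_)

Hypergraph : ℕ → ℕ → Set
Hypergraph n m = Fin m → Subset n

-- hyperedges are distinct as sets (E(H) is a set, |E(H)| = m)
DistinctEdges : ∀ {n m} → Hypergraph n m → Set
DistinctEdges E = ∀ i j → i ≢ j → E i ≢ E j

Linear : ∀ {n m} → Hypergraph n m → Set
Linear E = ∀ i j → i ≢ j → ∣ E i ∩ E j ∣ ≤ 1

degree : ∀ {n m} → Hypergraph n m → Fin n → ℕ
degree E v = ∣ tabulate (λ i → lookup (E i) v) ∣

MinDegree : ∀ {n m} → Hypergraph n m → ℕ → Set
MinDegree {n} E δ = (∀ v → δ ≤ degree E v) × Σ (Fin n) (λ v → degree E v ≡ δ)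

-- Lazy burning: Burned E B k v  means v is burned after k rounds
-- when B is burned initially.
Burned : ∀ {n m} → Hypergraph n m → Subset n → ℕ → Fin n → Set
Burned E B zero v = v ∈ B
Burned {n} {m} E B (suc k) v =
  Burned E B k v ⊎
  Σ (Fin m) (λ i → v ∈ E i × (∀ w → w ∈ E i → w ≢ v → Burned E B k w))

IsLazyBurningSet : ∀ {n m} → Hypergraph n m → Subset n → Set
IsLazyBurningSet {n} E B = Σ ℕ (λ k → ∀ (v : Fin n) → Burned E B k v)

IsLazyBurningNumber : ∀ {n m} → Hypergraph n m → ℕ → Set
IsLazyBurningNumber E b =
  Σ (Subset _) (λ B → IsLazyBurningSet E B × ∣ B ∣ ≡ b) ×
  (∀ B → IsLazyBurningSet E B → b ≤ ∣ B ∣)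

module Submission where

-- Order the vertices by lazy-burning time and add them latest first, tracking the
-- potential ∣ B ∩ W ∣ + (number of hyperedges meeting W) of the set W added so far.
-- The new vertex u burns no later than the vertices of W.  Either u ∈ B, or the
-- hyperedge that burned u meets no vertex of W; either way the potential grows.
-- By linearity u shares at most one hyperedge with each vertex of W, so when
-- ∣ W ∣ = j it brings at least δ - j new hyperedges.  The potential therefore grows
-- by at least max(1, δ - j) at step j; over j < n this sums to n + C(δ,2) provided
-- δ ≤ n, which holds because only one hyperedge through a vertex can meet no other vertex.

open import Defs
open import Data.Fin using (Fin; _≟_)
open import Data.Fin.Properties using (any?; all?)
open import Data.Fin.Subset
open import Data.Fin.Subset.Properties
  using (_∈?_; nonempty?; Empty-unique; ∣⊥∣≡0; ∣⁅x⁆∣≡1; x∈⁅x⁆; x∈⁅y⁆⇒x≡y; x≢y⇒x∉⁅y⁆;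
         x∈p∩q⁺; x∈p∩q⁻; x∈p∪q⁺; x∈p∪q⁻; q⊆p∪q; x∈∁p⇒x∉p; ∉⊥; ⊆-antisym;
         p⊆q⇒∣p∣≤∣q∣; p⊂q⇒∣p∣<∣q∣; ∣p∣≤n; ∣p∩q∣≤∣p∣; ∣p∩q∣≤∣q∣; ∩-distribˡ-∪)
open import Data.Vec using ([]; _∷_; tabulate; lookup)
open import Data.Vec.Properties using (lookup∘tabulate; []=⇒lookup; lookup⇒[]=)
open import Data.List using (List; []; _∷_; length; map; allFin)
open import Data.List.Properties using (length-tabulate)
open import Data.List.Membership.Propositional using () renaming (_∈_ to _∈ₗ_)
open import Data.List.Membership.Propositional.Properties using (∈-allFin)
open import Data.List.Relation.Unary.All as All using (All; []; _∷_)
open import Data.List.Relation.Unary.Any using (here; there)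
open import Data.List.Relation.Unary.AllPairs using (AllPairs; []; _∷_)
open import Data.List.Relation.Unary.Linked.Properties using (Linked⇒AllPairs)
open import Data.List.Relation.Unary.Unique.Propositional using (Unique)
open import Data.List.Relation.Unary.Unique.Propositional.Properties using (allFin⁺)
open import Data.List.Relation.Binary.Permutation.Propositional using (↭-sym; ↭⇒↭ₛ)
open import Data.List.Relation.Binary.Permutation.Propositional.Properties using (∈-resp-↭; ↭-length)
import Data.List.Relation.Binary.Permutation.Setoid.Properties as Permutationₛ
import Data.List.Sort as Sort
open import Data.Nat using (ℕ; zero; suc; pred; _+_; _∸_; _≤_; _<_; _≤′_; ≤′-refl; ≤′-step; z≤n; s≤s; _≤?_)
open import Data.Nat.Properties
  using (≤-trans; m≤m+n; m≤n+m; +-identityʳ; ≤-reflexive; <⇒≱; ≰⇒>; ≰⇒≥; 1+n≰n; ≤⇒≤′; +-comm; +-assoc; +-suc;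
         +-mono-≤; +-monoʳ-≤; +-monoˡ-≤; +-mono-<-≤; +-mono-≤-<; +-cancelʳ-≤;
         m≤n⇒m∸n≡0; m∸n+n≡m; pred[m∸n]≡m∸[1+n]; ≤-decTotalOrder; module ≤-Reasoning)
open import Data.Nat.Combinatorics using (_C_; nC1≡n; nCk+nC[k+1]≡[n+1]C[k+1])
open import Function using (_∘_)
open import Data.Product using (Σ; _×_; _,_; proj₁; proj₂)
open import Data.Sum using (inj₁; inj₂)
open import Relation.Binary.PropositionalEquality
open import Relation.Binary.Construct.On as On using ()
open import Relation.Nullary using (Dec; yes; no; ¬?; contradiction)
open import Relation.Nullary.Decidable using (_⊎-dec_; _×-dec_; _→-dec_)
open import Relation.Unary using (Decidable)

∣p∪q∣+∣p∩q∣≡∣p∣+∣q∣ : ∀ {n} (p q : Subset n) → ∣ p ∪ q ∣ + ∣ p ∩ q ∣ ≡ ∣ p ∣ + ∣ q ∣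
∣p∪q∣+∣p∩q∣≡∣p∣+∣q∣ [] [] = refl
∣p∪q∣+∣p∩q∣≡∣p∣+∣q∣ (outside ∷ p) (outside ∷ q) = ∣p∪q∣+∣p∩q∣≡∣p∣+∣q∣ p q
∣p∪q∣+∣p∩q∣≡∣p∣+∣q∣ (outside ∷ p) (inside ∷ q) =
  trans (cong suc (∣p∪q∣+∣p∩q∣≡∣p∣+∣q∣ p q)) (sym (+-suc ∣ p ∣ ∣ q ∣))
∣p∪q∣+∣p∩q∣≡∣p∣+∣q∣ (inside ∷ p) (outside ∷ q) = cong suc (∣p∪q∣+∣p∩q∣≡∣p∣+∣q∣ p q)
∣p∪q∣+∣p∩q∣≡∣p∣+∣q∣ (inside ∷ p) (inside ∷ q) = cong suc (begin
  ∣ p ∪ q ∣ + suc ∣ p ∩ q ∣ ≡⟨ +-suc ∣ p ∪ q ∣ ∣ p ∩ q ∣ ⟩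
  suc (∣ p ∪ q ∣ + ∣ p ∩ q ∣) ≡⟨ cong suc (∣p∪q∣+∣p∩q∣≡∣p∣+∣q∣ p q) ⟩
  suc (∣ p ∣ + ∣ q ∣) ≡⟨ sym (+-suc ∣ p ∣ ∣ q ∣) ⟩
  ∣ p ∣ + suc ∣ q ∣ ∎)
  where open ≡-Reasoning

∣p∪q∣≤∣p∣+∣q∣ : ∀ {n} (p q : Subset n) → ∣ p ∪ q ∣ ≤ ∣ p ∣ + ∣ q ∣
∣p∪q∣≤∣p∣+∣q∣ p q = ≤-trans (m≤m+n ∣ p ∪ q ∣ ∣ p ∩ q ∣) (≤-reflexive (∣p∪q∣+∣p∩q∣≡∣p∣+∣q∣ p q))

∣p∣≡∣p∩q∣+∣p∩∁q∣ : ∀ {n} (p q : Subset n) → ∣ p ∣ ≡ ∣ p ∩ q ∣ + ∣ p ∩ ∁ q ∣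
∣p∣≡∣p∩q∣+∣p∩∁q∣ [] [] = refl
∣p∣≡∣p∩q∣+∣p∩∁q∣ (outside ∷ p) (_ ∷ q) = ∣p∣≡∣p∩q∣+∣p∩∁q∣ p q
∣p∣≡∣p∩q∣+∣p∩∁q∣ (inside ∷ p) (inside ∷ q) = cong suc (∣p∣≡∣p∩q∣+∣p∩∁q∣ p q)
∣p∣≡∣p∩q∣+∣p∩∁q∣ (inside ∷ p) (outside ∷ q) =
  trans (cong suc (∣p∣≡∣p∩q∣+∣p∩∁q∣ p q)) (sym (+-suc ∣ p ∩ q ∣ ∣ p ∩ ∁ q ∣))

all-equal⇒∣p∣≤1 : ∀ {n} {p : Subset n} → (∀ {x y} → x ∈ p → y ∈ p → x ≡ y) → ∣ p ∣ ≤ 1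
all-equal⇒∣p∣≤1 {n} {p} all-equal with nonempty? p
... | yes (x , x∈p) = begin
  ∣ p ∣ ≤⟨ p⊆q⇒∣p∣≤∣q∣ (λ y∈p → subst (_∈ ⁅ x ⁆) (all-equal x∈p y∈p) (x∈⁅x⁆ x)) ⟩
  ∣ ⁅ x ⁆ ∣ ≡⟨ ∣⁅x⁆∣≡1 x ⟩
  1 ∎
  where open ≤-Reasoning
... | no empty = begin
  ∣ p ∣ ≡⟨ cong ∣_∣ (Empty-unique empty) ⟩
  ∣ ⊥ {n} ∣ ≡⟨ ∣⊥∣≡0 n ⟩
  0 ≤⟨ z≤n ⟩
  1 ∎
  where open ≤-Reasoning

x≢y⇒1<∣p∣ : ∀ {n} {x y : Fin n} {p : Subset n} → x ∈ p → y ∈ p → x ≢ y → 1 < ∣ p ∣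
x≢y⇒1<∣p∣ {x = x} {y} {p} x∈p y∈p x≢y =
  subst (_< ∣ p ∣) (∣⁅x⁆∣≡1 x) (p⊂q⇒∣p∣<∣q∣ (⁅x⁆⊆p , y , y∈p , x≢y⇒x∉⁅y⁆ (x≢y ∘ sym)))
  where
  ⁅x⁆⊆p : ⁅ x ⁆ ⊆ p
  ⁅x⁆⊆p z∈⁅x⁆ = subst (_∈ p) (sym (x∈⁅y⁆⇒x≡y x z∈⁅x⁆)) x∈p

[1+n]C2≡n+nC2 : ∀ n → suc n C 2 ≡ n + n C 2
[1+n]C2≡n+nC2 n = trans (sym (nCk+nC[k+1]≡[n+1]C[k+1] n 1)) (cong (_+ n C 2) (nC1≡n n))

nC2≡pred[n]+pred[n]C2 : ∀ n → n C 2 ≡ pred n + pred n C 2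
nC2≡pred[n]+pred[n]C2 zero = refl
nC2≡pred[n]+pred[n]C2 (suc n) = [1+n]C2≡n+nC2 n

[m∸n]C2≡m∸[1+n]+[m∸[1+n]]C2 : ∀ m n → (m ∸ n) C 2 ≡ m ∸ suc n + (m ∸ suc n) C 2
[m∸n]C2≡m∸[1+n]+[m∸[1+n]]C2 m n =
  trans (nC2≡pred[n]+pred[n]C2 (m ∸ n)) (cong (λ k → k + k C 2) (pred[m∸n]≡m∸[1+n] m n))

-- suc (δ ∸ suc j) is 1 ⊔ (δ ∸ j), and each hypothesis accounts for one side of the maximum.
x+[1+δ∸[1+j]]≤y : ∀ {x y δ j} → x < y → x + δ ≤ y + j → x + suc (δ ∸ suc j) ≤ y
x+[1+δ∸[1+j]]≤y {x} {y} {δ} {j} x<y x+δ≤y+j with suc j ≤? δ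
... | no  j≮δ = begin
  x + suc (δ ∸ suc j) ≡⟨ cong (λ d → x + suc d) (m≤n⇒m∸n≡0 (≰⇒≥ j≮δ)) ⟩
  x + 1 ≡⟨ +-comm x 1 ⟩
  suc x ≤⟨ x<y ⟩
  y ∎
  where open ≤-Reasoning
... | yes j<δ = +-cancelʳ-≤ j (x + suc (δ ∸ suc j)) y (begin
  x + suc (δ ∸ suc j) + j ≡⟨ +-assoc x (suc (δ ∸ suc j)) j ⟩
  x + (suc (δ ∸ suc j) + j) ≡⟨ cong (x +_) (sym (+-suc (δ ∸ suc j) j)) ⟩
  x + (δ ∸ suc j + suc j) ≡⟨ cong (x +_) (m∸n+n≡m j<δ) ⟩
  x + δ ≤⟨ x+δ≤y+j ⟩
  y + j ∎)
  where open ≤-Reasoning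

j+c≤x+[δ∸j]C2⇒[1+j]+c≤y+[δ∸[1+j]]C2 : ∀ {j c x y δ} → j + c ≤ x + (δ ∸ j) C 2 →
  x < y → x + δ ≤ y + j → suc j + c ≤ y + (δ ∸ suc j) C 2
j+c≤x+[δ∸j]C2⇒[1+j]+c≤y+[δ∸[1+j]]C2 {j} {c} {x} {y} {δ} inv x<y x+δ≤y+j = begin
  suc (j + c) ≤⟨ s≤s inv ⟩
  suc (x + (δ ∸ j) C 2) ≡⟨ cong (λ k → suc (x + k)) ([m∸n]C2≡m∸[1+n]+[m∸[1+n]]C2 δ j) ⟩
  suc (x + (d + d C 2)) ≡⟨ cong suc (sym (+-assoc x d (d C 2))) ⟩
  suc (x + d) + d C 2 ≡⟨ cong (_+ d C 2) (sym (+-suc x d)) ⟩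
  x + suc d + d C 2 ≤⟨ +-monoˡ-≤ (d C 2) (x+[1+δ∸[1+j]]≤y x<y x+δ≤y+j) ⟩
  y + d C 2 ∎
  where
  open ≤-Reasoning
  d : ℕ
  d = δ ∸ suc j

module _ {P : ℕ → Set} (P? : Decidable P) (P-suc : ∀ {k} → P k → P (suc k)) where

  P-mono : ∀ {i j} → i ≤ j → P i → P j
  P-mono i≤j = go (≤⇒≤′ i≤j)
    where
    go : ∀ {i j} → i ≤′ j → P i → P j
    go ≤′-refl p = p
    go (≤′-step i≤′j) p = P-suc (go i≤′j p)

  least-witness : ∀ k → P k → Σ ℕ λ j → P j × (∀ {i} → P i → j ≤ i)
  least-witness zero p = zero , p , λ _ → z≤n
  least-witness (suc k) p with P? k
  ... | yes pk = least-witness k pk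
  ... | no ¬pk = suc k , p , λ pi → ≰⇒> (λ i≤k → ¬pk (P-mono i≤k pi))

burned? : ∀ {n m} (E : Hypergraph n m) (B : Subset n) k v → Dec (Burned E B k v)
burned? E B zero v = v ∈? B
burned? E B (suc k) v =
  burned? E B k v ⊎-dec any? λ i →
    (v ∈? E i) ×-dec all? λ w → (w ∈? E i) →-dec (¬? (w ≟ v) →-dec burned? E B k w)

IsBurningTime : ∀ {n m} → Hypergraph n m → Subset n → (Fin n → ℕ) → Set
IsBurningTime {n} {m} E B t =
  ∀ u → u ∉ B → Σ (Fin m) λ e → u ∈ E e × (∀ w → w ∈ E e → w ≢ u → t w < t u)

lazyBurningSet⇒burningTime : ∀ {n m} {E : Hypergraph n m} {B : Subset n} →
  IsLazyBurningSet E B → Σ (Fin n → ℕ) (IsBurningTime E B)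
lazyBurningSet⇒burningTime {n} {E = E} {B} (K , allBurned) = t , burning
  where
  earliest : ∀ v → Σ ℕ λ j → Burned E B j v × (∀ {i} → Burned E B i v → j ≤ i)
  earliest v = least-witness (λ k → burned? E B k v) inj₁ K (allBurned v)

  t : Fin n → ℕ
  t v = proj₁ (earliest v)

  burning : IsBurningTime E B t
  burning u u∉B with earliest u
  ... | zero , u∈B , _ = contradiction u∈B u∉B
  ... | suc k , inj₁ burnedEarlier , least = contradiction (least burnedEarlier) 1+n≰n
  ... | suc k , inj₂ (e , u∈e , othersBurned) , _ =
    e , u∈e , λ w w∈e w≢u → s≤s (proj₂ (proj₂ (earliest w)) (othersBurned w w∈e w≢u))

toSubset : ∀ {n} → List (Fin n) → Subset n
toSubset ws = ⋃ (map ⁅_⁆ ws)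

∉-toSubset : ∀ {n} {u : Fin n} {ws} → All (u ≢_) ws → u ∉ toSubset ws
∉-toSubset [] = ∉⊥
∉-toSubset {ws = w ∷ ws} (u≢w ∷ u∉ws) u∈ with x∈p∪q⁻ ⁅ w ⁆ (toSubset ws) u∈
... | inj₁ u∈⁅w⁆ = u≢w (x∈⁅y⁆⇒x≡y w u∈⁅w⁆)
... | inj₂ u∈ws = ∉-toSubset u∉ws u∈ws

module Incidence {n m} (E : Hypergraph n m) where

  -- degree E v is definitionally ∣ edgesAt v ∣.
  edgesAt : Fin n → Subset m
  edgesAt v = tabulate (λ i → lookup (E i) v)

  ∈-edgesAt⁺ : ∀ {u i} → u ∈ E i → i ∈ edgesAt u
  ∈-edgesAt⁺ {u} {i} u∈Ei =
    lookup⇒[]= i (edgesAt u) (trans (lookup∘tabulate (λ i → lookup (E i) u) i) ([]=⇒lookup u∈Ei))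

  ∈-edgesAt⁻ : ∀ {u i} → i ∈ edgesAt u → u ∈ E i
  ∈-edgesAt⁻ {u} {i} i∈ =
    lookup⇒[]= u (E i) (trans (sym (lookup∘tabulate (λ i → lookup (E i) u) i)) ([]=⇒lookup i∈))

  edgesMeeting : List (Fin n) → Subset m
  edgesMeeting ws = ⋃ (map edgesAt ws)

  ∈-edgesMeeting⁺ : ∀ {w i ws} → w ∈ₗ ws → i ∈ edgesAt w → i ∈ edgesMeeting ws
  ∈-edgesMeeting⁺ (here refl) i∈ = x∈p∪q⁺ (inj₁ i∈)
  ∈-edgesMeeting⁺ (there w∈ws) i∈ = x∈p∪q⁺ (inj₂ (∈-edgesMeeting⁺ w∈ws i∈))

  ∉-edgesMeeting : ∀ {i ws} → All (_∉ E i) ws → i ∉ edgesMeeting ws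
  ∉-edgesMeeting [] = ∉⊥
  ∉-edgesMeeting {ws = w ∷ ws} (w∉Ei ∷ ws∉Ei) i∈ with x∈p∪q⁻ (edgesAt w) (edgesMeeting ws) i∈
  ... | inj₁ i∈edgesAt = w∉Ei (∈-edgesAt⁻ i∈edgesAt)
  ... | inj₂ i∈edgesMeeting = ∉-edgesMeeting ws∉Ei i∈edgesMeeting

  module _ (linear : Linear E) where

    ∣edgesAt∩edgesAt∣≤1 : ∀ {u w} → u ≢ w → ∣ edgesAt u ∩ edgesAt w ∣ ≤ 1
    ∣edgesAt∩edgesAt∣≤1 {u} {w} u≢w = all-equal⇒∣p∣≤1 same
      where
      both : ∀ {i} → i ∈ edgesAt u ∩ edgesAt w → u ∈ E i × w ∈ E i
      both i∈ with x∈p∩q⁻ (edgesAt u) (edgesAt w) i∈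
      ... | i∈u , i∈w = ∈-edgesAt⁻ i∈u , ∈-edgesAt⁻ i∈w

      same : ∀ {i j} → i ∈ edgesAt u ∩ edgesAt w → j ∈ edgesAt u ∩ edgesAt w → i ≡ j
      same {i} {j} i∈ j∈ with i ≟ j
      ... | yes i≡j = i≡j
      ... | no i≢j = contradiction (linear i j i≢j) (<⇒≱ (x≢y⇒1<∣p∣ u∈Ei∩Ej w∈Ei∩Ej u≢w))
        where
        u∈Ei∩Ej = x∈p∩q⁺ (proj₁ (both i∈) , proj₁ (both j∈))
        w∈Ei∩Ej = x∈p∩q⁺ (proj₂ (both i∈) , proj₂ (both j∈))

    ∣edgesAt∩edgesMeeting∣≤length : ∀ {u} ws → All (u ≢_) ws →
      ∣ edgesAt u ∩ edgesMeeting ws ∣ ≤ length ws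
    ∣edgesAt∩edgesMeeting∣≤length {u} [] [] =
      ≤-trans (∣p∩q∣≤∣q∣ (edgesAt u) ⊥) (≤-reflexive (∣⊥∣≡0 m))
    ∣edgesAt∩edgesMeeting∣≤length {u} (w ∷ ws) (u≢w ∷ u∉ws) = begin
      ∣ edgesAt u ∩ (edgesAt w ∪ edgesMeeting ws) ∣
        ≡⟨ cong ∣_∣ (∩-distribˡ-∪ (edgesAt u) (edgesAt w) (edgesMeeting ws)) ⟩
      ∣ (edgesAt u ∩ edgesAt w) ∪ (edgesAt u ∩ edgesMeeting ws) ∣
        ≤⟨ ∣p∪q∣≤∣p∣+∣q∣ (edgesAt u ∩ edgesAt w) (edgesAt u ∩ edgesMeeting ws) ⟩
      ∣ edgesAt u ∩ edgesAt w ∣ + ∣ edgesAt u ∩ edgesMeeting ws ∣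
        ≤⟨ +-mono-≤ (∣edgesAt∩edgesAt∣≤1 u≢w) (∣edgesAt∩edgesMeeting∣≤length ws u∉ws) ⟩
      suc (length ws) ∎
      where open ≤-Reasoning

    ∣edgesMeeting∣+δ≤∣edgesAt∪edgesMeeting∣+length : ∀ {u δ} ws → All (u ≢_) ws → δ ≤ degree E u →
      ∣ edgesMeeting ws ∣ + δ ≤ ∣ edgesAt u ∪ edgesMeeting ws ∣ + length ws
    ∣edgesMeeting∣+δ≤∣edgesAt∪edgesMeeting∣+length {u} {δ} ws u∉ws δ≤deg = begin
      ∣ S ∣ + δ ≤⟨ +-monoʳ-≤ ∣ S ∣ δ≤deg ⟩
      ∣ S ∣ + ∣ edgesAt u ∣ ≡⟨ +-comm ∣ S ∣ ∣ edgesAt u ∣ ⟩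
      ∣ edgesAt u ∣ + ∣ S ∣ ≡⟨ sym (∣p∪q∣+∣p∩q∣≡∣p∣+∣q∣ (edgesAt u) S) ⟩
      ∣ edgesAt u ∪ S ∣ + ∣ edgesAt u ∩ S ∣
        ≤⟨ +-monoʳ-≤ ∣ edgesAt u ∪ S ∣ (∣edgesAt∩edgesMeeting∣≤length ws u∉ws) ⟩
      ∣ edgesAt u ∪ S ∣ + length ws ∎
      where
      open ≤-Reasoning
      S : Subset m
      S = edgesMeeting ws

    -- Edges at u meeting no other vertex equal ⁅ u ⁆, so distinctness allows at most one.
    degree≤1+length : DistinctEdges E → ∀ {u} ws → All (u ≢_) ws → (∀ v → v ∈ₗ u ∷ ws) →
      degree E u ≤ suc (length ws)
    degree≤1+length distinct {u} ws u∉ws complete = begin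
      ∣ edgesAt u ∣ ≡⟨ ∣p∣≡∣p∩q∣+∣p∩∁q∣ (edgesAt u) (edgesMeeting ws) ⟩
      ∣ edgesAt u ∩ edgesMeeting ws ∣ + ∣ edgesAt u ∩ ∁ (edgesMeeting ws) ∣
        ≤⟨ +-mono-≤ (∣edgesAt∩edgesMeeting∣≤length ws u∉ws) (all-equal⇒∣p∣≤1 same) ⟩
      length ws + 1 ≡⟨ +-comm (length ws) 1 ⟩
      suc (length ws) ∎
      where
      open ≤-Reasoning
      Ei≡⁅u⁆ : ∀ {i} → i ∈ edgesAt u ∩ ∁ (edgesMeeting ws) → E i ≡ ⁅ u ⁆
      Ei≡⁅u⁆ {i} i∈ with x∈p∩q⁻ (edgesAt u) (∁ (edgesMeeting ws)) i∈
      ... | i∈edgesAt , i∉edgesMeeting = ⊆-antisym Ei⊆⁅u⁆ ⁅u⁆⊆Ei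
        where
        Ei⊆⁅u⁆ : E i ⊆ ⁅ u ⁆
        Ei⊆⁅u⁆ {v} v∈Ei with complete v
        ... | here refl = x∈⁅x⁆ u
        ... | there v∈ws = contradiction (∈-edgesMeeting⁺ v∈ws (∈-edgesAt⁺ v∈Ei)) (x∈∁p⇒x∉p i∉edgesMeeting)
        ⁅u⁆⊆Ei : ⁅ u ⁆ ⊆ E i
        ⁅u⁆⊆Ei v∈⁅u⁆ = subst (_∈ E i) (sym (x∈⁅y⁆⇒x≡y u v∈⁅u⁆)) (∈-edgesAt⁻ i∈edgesAt)

      same : ∀ {i j} → i ∈ edgesAt u ∩ ∁ (edgesMeeting ws) → j ∈ edgesAt u ∩ ∁ (edgesMeeting ws) → i ≡ j
      same {i} {j} i∈ j∈ with i ≟ j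
      ... | yes i≡j = i≡j
      ... | no i≢j = contradiction (trans (Ei≡⁅u⁆ i∈) (sym (Ei≡⁅u⁆ j∈))) (distinct i j i≢j)

    minDegree≤length : DistinctEdges E → ∀ {δ} → (∀ v → δ ≤ degree E v) → Fin n →
      ∀ ws → Unique ws → (∀ v → v ∈ₗ ws) → δ ≤ length ws
    minDegree≤length _ _ v [] _ complete with complete v
    ... | ()
    minDegree≤length distinct δ≤degree _ (u ∷ ws) (u∉ws ∷ _) complete =
      ≤-trans (δ≤degree u) (degree≤1+length distinct ws u∉ws complete)

module ByTime {n} (t : Fin n → ℕ) where

  open Sort (On.decTotalOrder ≤-decTotalOrder t) using (sort; sort-↭; sort-↗)

  byTime : List (Fin n)
  byTime = sort (allFin n)

  byTime-sorted : AllPairs (λ u w → t u ≤ t w) byTime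
  byTime-sorted = Linked⇒AllPairs ≤-trans (sort-↗ (allFin n))

  byTime-unique : Unique byTime
  byTime-unique = Permutationₛ.Unique-resp-↭ (setoid (Fin n)) (↭⇒↭ₛ (↭-sym (sort-↭ (allFin n)))) (allFin⁺ n)

  ∈-byTime : ∀ v → v ∈ₗ byTime
  ∈-byTime v = ∈-resp-↭ (↭-sym (sort-↭ (allFin n))) (∈-allFin v)

  length-byTime : length byTime ≡ n
  length-byTime = trans (↭-length (sort-↭ (allFin n))) (length-tabulate (λ v → v))

module Potential {n m} (E : Hypergraph n m) (B : Subset n) where

  open Incidence E

  potential : List (Fin n) → ℕ
  potential ws = ∣ B ∩ toSubset ws ∣ + ∣ edgesMeeting ws ∣

  module _ {t : Fin n → ℕ} {δ : ℕ}
    (linear : Linear E) (δ≤degree : ∀ v → δ ≤ degree E v) (burning : IsBurningTime E B t) where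

    module _ {u ws} (u≤ws : All (λ w → t u ≤ t w) ws) (u∉ws : All (u ≢_) ws) where

      private
        B∩ws⊆B∩u∷ws : B ∩ toSubset ws ⊆ B ∩ toSubset (u ∷ ws)
        B∩ws⊆B∩u∷ws v∈ with x∈p∩q⁻ B (toSubset ws) v∈
        ... | v∈B , v∈ws = x∈p∩q⁺ (v∈B , q⊆p∪q ⁅ u ⁆ (toSubset ws) v∈ws)

      potential<potential∷ : potential ws < potential (u ∷ ws)
      potential<potential∷ with u ∈? B
      ... | yes u∈B = +-mono-<-≤ (p⊂q⇒∣p∣<∣q∣ (B∩ws⊆B∩u∷ws , u , u∈B∩u∷ws , u∉B∩ws))
                                 (p⊆q⇒∣p∣≤∣q∣ (q⊆p∪q (edgesAt u) (edgesMeeting ws)))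
        where
        u∈B∩u∷ws : u ∈ B ∩ toSubset (u ∷ ws)
        u∈B∩u∷ws = x∈p∩q⁺ (u∈B , x∈p∪q⁺ (inj₁ (x∈⁅x⁆ u)))
        u∉B∩ws : u ∉ B ∩ toSubset ws
        u∉B∩ws u∈B∩ws = ∉-toSubset u∉ws (proj₂ (x∈p∩q⁻ B (toSubset ws) u∈B∩ws))
      ... | no u∉B with burning u u∉B
      ...   | e , u∈e , earlier = +-mono-≤-< (p⊆q⇒∣p∣≤∣q∣ B∩ws⊆B∩u∷ws)
              (p⊂q⇒∣p∣<∣q∣ (q⊆p∪q (edgesAt u) (edgesMeeting ws) , e ,
                            x∈p∪q⁺ (inj₁ (∈-edgesAt⁺ u∈e)) , ∉-edgesMeeting ws∉e))
        where
        ws∉e : All (_∉ E e) ws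
        ws∉e = All.zipWith (λ (u≤w , u≢w) w∈e → <⇒≱ (earlier _ w∈e (u≢w ∘ sym)) u≤w) (u≤ws , u∉ws)

      potential+δ≤potential∷+length : potential ws + δ ≤ potential (u ∷ ws) + length ws
      potential+δ≤potential∷+length = begin
        ∣ B ∩ toSubset ws ∣ + ∣ edgesMeeting ws ∣ + δ
          ≡⟨ +-assoc ∣ B ∩ toSubset ws ∣ ∣ edgesMeeting ws ∣ δ ⟩
        ∣ B ∩ toSubset ws ∣ + (∣ edgesMeeting ws ∣ + δ)
          ≤⟨ +-mono-≤ (p⊆q⇒∣p∣≤∣q∣ B∩ws⊆B∩u∷ws)
                      (∣edgesMeeting∣+δ≤∣edgesAt∪edgesMeeting∣+length linear ws u∉ws (δ≤degree u)) ⟩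
        ∣ B ∩ toSubset (u ∷ ws) ∣ + (∣ edgesMeeting (u ∷ ws) ∣ + length ws)
          ≡⟨ sym (+-assoc ∣ B ∩ toSubset (u ∷ ws) ∣ ∣ edgesMeeting (u ∷ ws) ∣ (length ws)) ⟩
        potential (u ∷ ws) + length ws ∎
        where open ≤-Reasoning

    length+δC2≤potential : ∀ ws → AllPairs (λ u w → t u ≤ t w) ws → Unique ws →
      length ws + δ C 2 ≤ potential ws + (δ ∸ length ws) C 2
    length+δC2≤potential [] [] [] = m≤n+m (δ C 2) (potential [])
    length+δC2≤potential (u ∷ ws) (u≤ws ∷ sorted) (u∉ws ∷ unique) =
      j+c≤x+[δ∸j]C2⇒[1+j]+c≤y+[δ∸[1+j]]C2 (length+δC2≤potential ws sorted unique)
        (potential<potential∷ u≤ws u∉ws) (potential+δ≤potential∷+length u≤ws u∉ws)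

burningTime⇒n+δC2≤∣B∣+m : ∀ {n m} {E : Hypergraph n m} {B t δ} → DistinctEdges E → Linear E →
  (∀ v → δ ≤ degree E v) → Fin n → IsBurningTime E B t → n + δ C 2 ≤ ∣ B ∣ + m
burningTime⇒n+δC2≤∣B∣+m {n} {m} {E} {B} {t} {δ} distinct linear δ≤degree v burning = begin
  n + δ C 2 ≡⟨ cong (_+ δ C 2) (sym length-byTime) ⟩
  length byTime + δ C 2 ≤⟨ length+δC2≤potential linear δ≤degree burning byTime byTime-sorted byTime-unique ⟩
  potential byTime + (δ ∸ length byTime) C 2 ≡⟨ cong (λ k → potential byTime + k C 2) (m≤n⇒m∸n≡0 δ≤length) ⟩
  potential byTime + 0 ≡⟨ +-identityʳ (potential byTime) ⟩
  ∣ B ∩ toSubset byTime ∣ + ∣ edgesMeeting byTime ∣ ≤⟨ +-mono-≤ (∣p∩q∣≤∣p∣ B (toSubset byTime)) (∣p∣≤n (edgesMeeting byTime)) ⟩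
  ∣ B ∣ + m ∎
  where
  open ≤-Reasoning
  open ByTime t
  open Incidence E
  open Potential E B
  δ≤length : δ ≤ length byTime
  δ≤length = minDegree≤length linear distinct δ≤degree v byTime byTime-unique ∈-byTime

corollary2p12 : ∀ (n m : ℕ) (E : Hypergraph n m) (δ b : ℕ) →
    DistinctEdges E → Linear E → MinDegree E δ → δ ≤ m →
    IsLazyBurningNumber E b →
    n + (δ C 2) ≤ b + m
corollary2p12 n m E δ b distinct linear (δ≤degree , v , _) _ ((B , lazy , ∣B∣≡b) , _)
  with lazyBurningSet⇒burningTime lazy
... | _ , burning =
  subst (λ k → n + δ C 2 ≤ k + m) ∣B∣≡b (burningTime⇒n+δC2≤∣B∣+m distinct linear δ≤degree v burning)
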